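{- The category $\mathbf{W}$ whose objects are finite sets of natural numbers and whose morphisms are injective functions, with subset inclusions as the subcategory of inclusions, is a category of worlds.
   Context: A category of worlds is a category with pullbacks in which every span $u:\underline{w}\to w$, $u':\underline{w}\to w'$ can be completed to a minimal pullback square (a pullback $xu=x'u'$ with apex $\overline{w}$ such that for any other pullback $x_1u=x_1'u'$ over the same span with apex $\overline{w_1}$ there is a unique $t:\overline{w}\to\overline{w_1}$ with $x_1=tx$, $x_1'=tx'$), together with a subcategory of inclusions, full on objects, which is a poset, such that every morphism factors as an inclusion followed by an isomorphism and as an isomorphism followed by an inclusion. -}

module Defs where

open import Level using (Level; _⊔_) renaming (suc to lsuc)
open import Data.Nat using (ℕ; _<_)
open import Data.List using (List)
open import Data.List.Relation.Unary.Linked using (Linked)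
open import Data.Bool using (Bool; true; false; T; _∨_)
open import Data.Bool.Properties using (T-irrelevant)
open import Data.Nat using (_≡ᵇ_)
open import Data.List using ([]; _∷_)
open import Data.Product using (Σ; Σ-syntax; ∃-syntax; _×_; _,_; proj₁; proj₂)
open import Relation.Binary.PropositionalEquality using (_≡_; refl; sym; trans; cong)
open import Relation.Binary.Structures using (IsEquivalence)

record Category (o ℓ e : Level) : Set (lsuc (o ⊔ ℓ ⊔ e)) where
  infixr 9 _∘_
  infix  4 _≈_
  field
    Obj   : Set o
    Hom   : Obj → Obj → Set ℓ
    _≈_   : ∀ {a b} → Hom a b → Hom a b → Set e
    id    : ∀ {a} → Hom a a
    _∘_   : ∀ {a b c} → Hom b c → Hom a b → Hom a c
    ≈-equiv : ∀ {a b} → IsEquivalence (_≈_ {a} {b})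
    ∘-resp-≈ : ∀ {a b c} {f f' : Hom b c} {g g' : Hom a b} →
               f ≈ f' → g ≈ g' → f ∘ g ≈ f' ∘ g'
    identityˡ : ∀ {a b} {f : Hom a b} → id ∘ f ≈ f
    identityʳ : ∀ {a b} {f : Hom a b} → f ∘ id ≈ f
    assoc : ∀ {a b c d} {f : Hom c d} {g : Hom b c} {h : Hom a b} →
            (f ∘ g) ∘ h ≈ f ∘ (g ∘ h)

module _ {o ℓ e : Level} (C : Category o ℓ e) where
  open Category C

  IsIso : ∀ {a b} → Hom a b → Set (ℓ ⊔ e)
  IsIso {a} {b} f = Σ[ g ∈ Hom b a ] (g ∘ f ≈ id × f ∘ g ≈ id)

  IsPullback : ∀ {p w w' q} (u : Hom p w) (u' : Hom p w')
               (x : Hom w q) (x' : Hom w' q) → Set (o ⊔ ℓ ⊔ e)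
  IsPullback {p} {w} {w'} {q} u u' x x' =
    (x ∘ u ≈ x' ∘ u') ×
    (∀ {r} (v : Hom r w) (v' : Hom r w') → x ∘ v ≈ x' ∘ v' →
       Σ[ h ∈ Hom r p ] ((u ∘ h ≈ v × u' ∘ h ≈ v') ×
         (∀ (h' : Hom r p) → u ∘ h' ≈ v → u' ∘ h' ≈ v' → h' ≈ h)))

  HasPullbacks : Set (o ⊔ ℓ ⊔ e)
  HasPullbacks = ∀ {w w' q} (x : Hom w q) (x' : Hom w' q) →
    Σ[ p ∈ Obj ] Σ[ u ∈ Hom p w ] Σ[ u' ∈ Hom p w' ] IsPullback u u' x x'

  IsMinimalPullback : ∀ {p w w' q} (u : Hom p w) (u' : Hom p w')
                      (x : Hom w q) (x' : Hom w' q) → Set (o ⊔ ℓ ⊔ e)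
  IsMinimalPullback {p} {w} {w'} {q} u u' x x' =
    IsPullback u u' x x' ×
    (∀ {q₁} (x₁ : Hom w q₁) (x₁' : Hom w' q₁) → IsPullback u u' x₁ x₁' →
       Σ[ t ∈ Hom q q₁ ] ((x₁ ≈ t ∘ x × x₁' ≈ t ∘ x') ×
         (∀ (t' : Hom q q₁) → x₁ ≈ t' ∘ x → x₁' ≈ t' ∘ x' → t' ≈ t)))

  HasMinimalPullbackCompletions : Set (o ⊔ ℓ ⊔ e)
  HasMinimalPullbackCompletions = ∀ {p w w'} (u : Hom p w) (u' : Hom p w') →
    Σ[ q ∈ Obj ] Σ[ x ∈ Hom w q ] Σ[ x' ∈ Hom w' q ] IsMinimalPullback u u' x x'

  record IsInclusionSubcategory {i : Level} (Incl : ∀ {a b} → Hom a b → Set i)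
         : Set (o ⊔ ℓ ⊔ e ⊔ i) where
    field
      incl-id   : ∀ {a} → Incl (id {a})
      incl-∘    : ∀ {a b c} {f : Hom b c} {g : Hom a b} → Incl f → Incl g → Incl (f ∘ g)
      incl-thin : ∀ {a b} {f g : Hom a b} → Incl f → Incl g → f ≈ g
      incl-antisym : ∀ {a b} {f : Hom a b} {g : Hom b a} → Incl f → Incl g → a ≡ b
      factor-incl-iso : ∀ {a b} (f : Hom a b) →
        Σ[ c ∈ Obj ] Σ[ j ∈ Hom a c ] Σ[ k ∈ Hom c b ]
          (Incl j × IsIso k × f ≈ k ∘ j)
      factor-iso-incl : ∀ {a b} (f : Hom a b) →
        Σ[ c ∈ Obj ] Σ[ k ∈ Hom a c ] Σ[ j ∈ Hom c b ]
          (IsIso k × Incl j × f ≈ j ∘ k)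

  record IsCategoryOfWorlds {i : Level} (Incl : ∀ {a b} → Hom a b → Set i)
         : Set (o ⊔ ℓ ⊔ e ⊔ i) where
    field
      pullbacks         : HasPullbacks
      minimal-pullbacks : HasMinimalPullbackCompletions
      inclusions        : IsInclusionSubcategory Incl

-- The category W: finite sets of natural numbers (canonically represented
-- as strictly increasing lists, so that equal sets are equal objects) and
-- injective functions between them.

FinSetℕ : Set
FinSetℕ = Σ[ xs ∈ List ℕ ] Linked _<_ xs

_∈ᵇ_ : ℕ → List ℕ → Bool
n ∈ᵇ []       = false
n ∈ᵇ (x ∷ xs) = (n ≡ᵇ x) ∨ (n ∈ᵇ xs)

-- the elements of a finite set (membership proof is irrelevant)
El : FinSetℕ → Set
El A = Σ[ n ∈ ℕ ] T (n ∈ᵇ proj₁ A)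

-- injective functions (a record, so that source/target are inferable)
record InjFun (A B : FinSetℕ) : Set where
  constructor inj
  field
    fun : El A → El B
    injective : ∀ (x y : El A) → proj₁ (fun x) ≡ proj₁ (fun y) → proj₁ x ≡ proj₁ y
open InjFun public

_≈W_ : ∀ {A B} → InjFun A B → InjFun A B → Set
_≈W_ {A} f g = ∀ (x : El A) → proj₁ (fun f x) ≡ proj₁ (fun g x)

idW : ∀ {A} → InjFun A A
idW = inj (λ x → x) (λ x y p → p)

_∘W_ : ∀ {A B C} → InjFun B C → InjFun A B → InjFun A C
inj f fi ∘W inj g gi = inj (λ x → f (g x)) (λ x y p → gi x y (fi (g x) (g y) p))

El-≡ : ∀ {A} (x y : El A) → proj₁ x ≡ proj₁ y → x ≡ y
El-≡ (n , p) (.n , q) refl = cong (n ,_) (T-irrelevant p q)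

W : Category _ _ _
W = record
  { Obj = FinSetℕ
  ; Hom = InjFun
  ; _≈_ = _≈W_
  ; id = idW
  ; _∘_ = _∘W_
  ; ≈-equiv = record { refl = λ x → refl
                     ; sym = λ p x → sym (p x)
                     ; trans = λ p q x → trans (p x) (q x) }
  ; ∘-resp-≈ = λ {a} {b} {c} {f} {f'} {g} {g'} p q x →
      trans (cong (λ y → proj₁ (fun f y)) (El-≡ {b} (fun g x) (fun g' x) (q x)))
            (p (fun g' x))
  ; identityˡ = λ x → refl
  ; identityʳ = λ x → refl
  ; assoc = λ x → refl
  }

IsSubsetInclusion : ∀ {A B} → InjFun A B → Set
IsSubsetInclusion {A} f = ∀ (x : El A) → proj₁ (fun f x) ≡ proj₁ x

module Submission where

-- Pullbacks are computed as in sets: the pullback of x and x′ is {a ∈ X | x a ∈ im x′}, and a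
-- commuting square of injections is a pullback exactly when every pair of points identified by
-- the cospan comes from the apex.  The minimal completion of a span u, u′ is the disjoint union
-- X ⊔ (Y ∖ im u′), into which Y is mapped by u ∘ u′⁻¹ on im u′.  For any other pullback
-- completion (x₁, x₁′), the pullback condition forbids x₁′ from identifying a point of
-- Y ∖ im u′ with a point of x₁(X), so the copairing of x₁ and x₁′ is injective; it is the
-- unique comparison map.  Every morphism is an isomorphism onto its image followed by an
-- inclusion; and f : A → C is the inclusion A → A ⊔ (C ∖ im f) followed by the comparison map
-- from the minimal completion of the span (id, f) to the square (f, id), which is an
-- isomorphism in any category.

open import Defs
open import Data.Bool using (T)
open import Data.Bool.Properties using (T-∨; T?)
open import Data.Empty using (⊥-elim)
open import Data.List using (List; []; _∷_; _++_; map; filter)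
open import Data.List.Extrema.Nat using (max; xs≤max)
open import Data.List.Membership.Propositional using (_∈_; lose)
open import Data.List.Membership.Propositional.Properties
  using (∈-filter⁺; ∈-filter⁻; ∈-++⁺ˡ; ∈-++⁺ʳ; ∈-++⁻; ∈-map⁺; ∈-map⁻)
open import Data.List.Relation.Binary.Subset.Propositional using (_⊆_)
open import Data.List.Relation.Unary.All as All using (All)
open import Data.List.Relation.Unary.AllPairs as AllPairs using (AllPairs; []; _∷_)
import Data.List.Relation.Unary.AllPairs.Properties as AllPairsₚ
open import Data.List.Relation.Unary.Any using (Any; here; there; any?; satisfied)
import Data.List.Relation.Unary.Linked as Linked
import Data.List.Relation.Unary.Linked.Properties as Linkedₚ
open import Data.Nat using (ℕ; suc; _+_; _<_; s≤s; _≟_)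
open import Data.Nat.Properties
  using (≡ᵇ⇒≡; ≡⇒≡ᵇ; <-trans; <-irrefl; <-asym; <-irrelevant; <-≤-trans; m≤m+n;
         m+n≮m; +-monoʳ-<; +-cancelˡ-≡)
open import Data.Product using (Σ; Σ-syntax; _×_; _,_; proj₁; proj₂)
open import Data.Sum using (_⊎_; inj₁; inj₂)
open import Function using (_∘′_; Equivalence)
open import Relation.Nullary using (¬_; Dec; yes; no)
open import Relation.Nullary.Decidable using (map′; ¬?)
open import Relation.Unary using (Decidable)
open import Relation.Binary.PropositionalEquality
  using (_≡_; _≢_; refl; sym; trans; cong; cong₂; subst; module ≡-Reasoning)
open import Relation.Binary.Bundles using (Setoid)
open import Relation.Binary.Structures using (IsEquivalence)
import Relation.Binary.Reasoning.Setoid as SetoidReasoning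

module _ {o ℓ e} (C : Category o ℓ e) where
  open Category C

  private
    hom-setoid : Obj → Obj → Setoid ℓ e
    hom-setoid a b = record { isEquivalence = ≈-equiv {a} {b} }
    module ≈ {a b} = IsEquivalence (≈-equiv {a} {b})
    module HomReasoning {a b} = SetoidReasoning (hom-setoid a b)
    open HomReasoning

  identity-isPullback : ∀ {a b} (f : Hom a b) → IsPullback C id f f id
  identity-isPullback f = ≈.trans identityʳ (≈.sym identityˡ) , λ v v′ fv≈v′ →
    v , (identityˡ , ≈.trans fv≈v′ identityˡ) , λ h′ h′≈v _ → ≈.trans (≈.sym identityˡ) h′≈v

  idSpan-minimalPullback⇒factorisation :
    ∀ {a b q} {f : Hom a b} {x : Hom a q} {x′ : Hom b q} →
    IsMinimalPullback C id f x x′ → Σ[ t ∈ Hom q b ] (IsIso C t × f ≈ t ∘ x)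
  idSpan-minimalPullback⇒factorisation {f = f} {x} {x′} (pb@(square , _) , minimal)
    with minimal f id (identity-isPullback f)
  ... | t , (f≈t∘x , id≈t∘x′) , _ = t , (x′ , x′∘t≈id , ≈.sym id≈t∘x′) , f≈t∘x
    where
    unique : ∀ t′ → x ≈ t′ ∘ x → x′ ≈ t′ ∘ x′ → t′ ≈ proj₁ (minimal x x′ pb)
    unique = proj₂ (proj₂ (minimal x x′ pb))

    x≈x′∘t∘x : x ≈ (x′ ∘ t) ∘ x
    x≈x′∘t∘x = begin
      x             ≈⟨ identityʳ ⟨
      x ∘ id        ≈⟨ square ⟩
      x′ ∘ f        ≈⟨ ∘-resp-≈ ≈.refl f≈t∘x ⟩
      x′ ∘ (t ∘ x)  ≈⟨ assoc ⟨
      (x′ ∘ t) ∘ x  ∎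

    x′≈x′∘t∘x′ : x′ ≈ (x′ ∘ t) ∘ x′
    x′≈x′∘t∘x′ = begin
      x′             ≈⟨ identityʳ ⟨
      x′ ∘ id        ≈⟨ ∘-resp-≈ ≈.refl id≈t∘x′ ⟩
      x′ ∘ (t ∘ x′)  ≈⟨ assoc ⟨
      (x′ ∘ t) ∘ x′  ∎

    -- Both x′ ∘ t and id mediate from the completion (x, x′) to itself.
    x′∘t≈id : x′ ∘ t ≈ id
    x′∘t≈id = ≈.trans (unique (x′ ∘ t) x≈x′∘t∘x x′≈x′∘t∘x′)
                      (≈.sym (unique id (≈.sym identityˡ) (≈.sym identityˡ)))

∈ᵇ⇒∈ : ∀ {n} xs → T (n ∈ᵇ xs) → n ∈ xs
∈ᵇ⇒∈ {n} (x ∷ xs) p with Equivalence.to T-∨ p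
... | inj₁ n≡ᵇx  = here (≡ᵇ⇒≡ n x n≡ᵇx)
... | inj₂ n∈ᵇxs = there (∈ᵇ⇒∈ xs n∈ᵇxs)

∈⇒∈ᵇ : ∀ {n xs} → n ∈ xs → T (n ∈ᵇ xs)
∈⇒∈ᵇ {n} (here refl) = Equivalence.from T-∨ (inj₁ (≡⇒≡ᵇ n n refl))
∈⇒∈ᵇ (there n∈xs)    = Equivalence.from T-∨ (inj₂ (∈⇒∈ᵇ n∈xs))

elements : FinSetℕ → List ℕ
elements = proj₁

element : ∀ {A n} → n ∈ elements A → El A
element {n = n} n∈A = n , ∈⇒∈ᵇ n∈A

∈-element : ∀ {A} (a : El A) → proj₁ a ∈ elements A
∈-element {A} (n , p) = ∈ᵇ⇒∈ (elements A) p

infixl 9 _⟨$⟩_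
_⟨$⟩_ : ∀ {A B} → InjFun A B → El A → ℕ
f ⟨$⟩ a = proj₁ (fun f a)

⟨$⟩-cong : ∀ {A B} (f : InjFun A B) {a b : El A} → proj₁ a ≡ proj₁ b → f ⟨$⟩ a ≡ f ⟨$⟩ b
⟨$⟩-cong {A} f {a} {b} a≡b = cong (f ⟨$⟩_) (El-≡ {A} a b a≡b)

sorted : ∀ A → AllPairs _<_ (elements A)
sorted A = Linkedₚ.Linked⇒AllPairs <-trans (proj₂ A)

fromSorted : ∀ xs → AllPairs _<_ xs → FinSetℕ
fromSorted xs s = xs , Linkedₚ.AllPairs⇒Linked s

strictlySorted-≡ : ∀ {xs ys} → AllPairs _<_ xs → AllPairs _<_ ys → xs ⊆ ys → ys ⊆ xs → xs ≡ ys
strictlySorted-≡ {[]}    {[]}    _ _ _ _ = refl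
strictlySorted-≡ {[]}    {_ ∷ _} _ _ _ ys⊆xs with () ← ys⊆xs (here refl)
strictlySorted-≡ {_ ∷ _} {[]}    _ _ xs⊆ys _ with () ← xs⊆ys (here refl)
strictlySorted-≡ {x ∷ xs} {y ∷ ys} (x<xs ∷ sxs) (y<ys ∷ sys) xs⊆ys ys⊆xs =
  cong₂ _∷_ x≡y (strictlySorted-≡ sxs sys (tail-⊆ x<xs x≡y xs⊆ys) (tail-⊆ y<ys (sym x≡y) ys⊆xs))
  where
  x≡y : x ≡ y
  x≡y with xs⊆ys (here refl) | ys⊆xs (here refl)
  ... | here x≡y   | _          = x≡y
  ... | there _    | here y≡x   = sym y≡x
  ... | there x∈ys | there y∈xs = ⊥-elim (<-asym (All.lookup x<xs y∈xs) (All.lookup y<ys x∈ys))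

  tail-⊆ : ∀ {a as b bs} → All (a <_) as → a ≡ b → a ∷ as ⊆ b ∷ bs → as ⊆ bs
  tail-⊆ a<as a≡b ⊆ n∈as with ⊆ (there n∈as)
  ... | here n≡b   = ⊥-elim (<-irrefl (trans a≡b (sym n≡b)) (All.lookup a<as n∈as))
  ... | there n∈bs = n∈bs

FinSetℕ-≡ : ∀ {A B} → elements A ⊆ elements B → elements B ⊆ elements A → A ≡ B
FinSetℕ-≡ {A@(xs , p)} {B@(ys , q)} A⊆B B⊆A with strictlySorted-≡ (sorted A) (sorted B) A⊆B B⊆A
... | refl = cong (xs ,_) (Linked.irrelevant <-irrelevant p q)

inclusion⇒⊆ : ∀ {A B} (f : InjFun A B) → IsSubsetInclusion f → elements A ⊆ elements B
inclusion⇒⊆ {A} {B} f f-incl n∈A =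
  subst (_∈ elements B) (f-incl (element {A} n∈A)) (∈-element {B} (fun f (element {A} n∈A)))

bound : FinSetℕ → ℕ
bound A = suc (max 0 (elements A))

<bound : ∀ {A} (a : El A) → proj₁ a < bound A
<bound {A} a = s≤s (All.lookup (xs≤max 0 (elements A)) (∈-element {A} a))

Lifted : (A : FinSetℕ) (P : El A → Set) → ℕ → Set
Lifted A P n = Σ[ n∈A ∈ T (n ∈ᵇ elements A) ] P (n , n∈A)

module _ (A : FinSetℕ) {P : El A → Set} (P? : ∀ a → Dec (P a)) where

  lifted? : Decidable (Lifted A P)
  lifted? n with T? (n ∈ᵇ elements A)
  ... | no n∉A  = no (n∉A ∘′ proj₁)
  ... | yes n∈A = map′ (n∈A ,_) transport (P? (n , n∈A))
    where
    transport : Lifted A P n → P (n , n∈A)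
    transport (_ , Pn) = subst P (El-≡ {A} _ _ refl) Pn

  ∃? : Dec (Σ (El A) P)
  ∃? = map′ fromAny toAny (any? lifted? (elements A))
    where
    fromAny : Any (Lifted A P) (elements A) → Σ (El A) P
    fromAny any with satisfied any
    ... | n , n∈A , Pn = (n , n∈A) , Pn

    toAny : Σ (El A) P → Any (Lifted A P) (elements A)
    toAny ((n , n∈A) , Pn) = lose (∈ᵇ⇒∈ (elements A) n∈A) (n∈A , Pn)

module Subset (A : FinSetℕ) {P : El A → Set} (P? : ∀ a → Dec (P a)) where

  set : FinSetℕ
  set = filter (lifted? A P?) (elements A) , Linkedₚ.filter⁺ (lifted? A P?) <-trans (proj₂ A)

  lifted : (b : El set) → Lifted A P (proj₁ b)
  lifted b = proj₂ (∈-filter⁻ (lifted? A P?) {xs = elements A} (∈-element {set} b))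

  incl : InjFun set A
  incl = inj (λ b → proj₁ b , proj₁ (lifted b)) (λ _ _ e → e)

  incl-sat : (b : El set) → P (fun incl b)
  incl-sat b = proj₂ (lifted b)

  restrict : (a : El A) → P a → El set
  restrict a Pa = element {set} (∈-filter⁺ (lifted? A P?) (∈-element {A} a) (proj₂ a , Pa))

Image : ∀ {A B} → InjFun A B → ℕ → Set
Image {A} f m = Σ[ a ∈ El A ] f ⟨$⟩ a ≡ m

image? : ∀ {A B} (f : InjFun A B) → Decidable (Image f)
image? {A} f m = ∃? A (λ a → f ⟨$⟩ a ≟ m)

surjective⇒isIso : ∀ {A B} (f : InjFun A B) → (∀ b → Image f (proj₁ b)) → IsIso W f
surjective⇒isIso {A} {B} f surjective =
  g , (λ a → injective f _ a (proj₂ (surjective (fun f a)))) , λ b → proj₂ (surjective b)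
  where
  g : InjFun B A
  g = inj (λ b → proj₁ (surjective b)) λ b c gb≡gc →
    trans (sym (proj₂ (surjective b))) (trans (⟨$⟩-cong f gb≡gc) (proj₂ (surjective c)))

infixr 1 _⊎ₛ_
_⊎ₛ_ : FinSetℕ → FinSetℕ → FinSetℕ
A ⊎ₛ B = fromSorted (elements A ++ map (bound A +_) (elements B))
  (AllPairsₚ.++⁺ (sorted A) (AllPairsₚ.map⁺ (AllPairs.map (+-monoʳ-< (bound A)) (sorted B)))
                 (All.tabulate λ a∈A → All.tabulate (below-shifted a∈A)))
  where
  below-shifted : ∀ {a b} → a ∈ elements A → b ∈ map (bound A +_) (elements B) → a < b
  below-shifted {a} a∈A b∈B+ with ∈-map⁻ (bound A +_) b∈B+
  ... | m , _ , refl = <-≤-trans (<bound {A} (element {A} a∈A)) (m≤m+n (bound A) m)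

module Injections (A B : FinSetℕ) where

  inl : InjFun A (A ⊎ₛ B)
  inl = inj (λ a → element {A ⊎ₛ B} (∈-++⁺ˡ (∈-element {A} a))) (λ _ _ e → e)

  inr : InjFun B (A ⊎ₛ B)
  inr = inj (λ b → element {A ⊎ₛ B} (∈-++⁺ʳ (elements A) (∈-map⁺ (bound A +_) (∈-element {B} b))))
            (λ _ _ → +-cancelˡ-≡ (bound A) _ _)

  inl≢inr : ∀ a b → inl ⟨$⟩ a ≢ inr ⟨$⟩ b
  inl≢inr a b a≡A+b = m+n≮m (bound A) (proj₁ b) (subst (_< bound A) a≡A+b (<bound {A} a))

  inl-or-inr : (g : El (A ⊎ₛ B)) → Image inl (proj₁ g) ⊎ Image inr (proj₁ g)
  inl-or-inr g with ∈-++⁻ (elements A) (∈-element {A ⊎ₛ B} g)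
  ... | inj₁ g∈A = inj₁ (element {A} g∈A , refl)
  ... | inj₂ g∈B+ with ∈-map⁻ (bound A +_) g∈B+
  ...   | m , m∈B , g≡A+m = inj₂ (element {B} m∈B , sym g≡A+m)

  module _ {C : FinSetℕ} where

    ⊎ₛ-ext : (h k : InjFun (A ⊎ₛ B) C) →
             (h ∘W inl) ≈W (k ∘W inl) → (h ∘W inr) ≈W (k ∘W inr) → h ≈W k
    ⊎ₛ-ext h k hl≈kl hr≈kr g with inl-or-inr g
    ... | inj₁ (a , a↦g) = trans (⟨$⟩-cong h (sym a↦g)) (trans (hl≈kl a) (⟨$⟩-cong k a↦g))
    ... | inj₂ (b , b↦g) = trans (⟨$⟩-cong h (sym b↦g)) (trans (hr≈kr b) (⟨$⟩-cong k b↦g))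

    module _ (f : InjFun A C) (g : InjFun B C) (disjoint : ∀ a b → f ⟨$⟩ a ≢ g ⟨$⟩ b) where

      copair : InjFun (A ⊎ₛ B) C
      copair = inj copair-fun copair-injective
        where
        copair-fun : El (A ⊎ₛ B) → El C
        copair-fun x with inl-or-inr x
        ... | inj₁ (a , _) = fun f a
        ... | inj₂ (b , _) = fun g b

        copair-injective : ∀ x y → proj₁ (copair-fun x) ≡ proj₁ (copair-fun y) → proj₁ x ≡ proj₁ y
        copair-injective x y fx≡fy with inl-or-inr x | inl-or-inr y
        ... | inj₁ (a , a↦x) | inj₁ (a′ , a′↦y) =
          trans (sym a↦x) (trans (injective f a a′ fx≡fy) a′↦y)
        ... | inj₁ (a , _)   | inj₂ (b , _)     = ⊥-elim (disjoint a b fx≡fy)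
        ... | inj₂ (b , _)   | inj₁ (a , _)     = ⊥-elim (disjoint a b (sym fx≡fy))
        ... | inj₂ (b , b↦x) | inj₂ (b′ , b′↦y) =
          trans (sym b↦x) (trans (⟨$⟩-cong inr {b} {b′} (injective g b b′ fx≡fy)) b′↦y)

      copair-at-inl : ∀ x a → inl ⟨$⟩ a ≡ proj₁ x → copair ⟨$⟩ x ≡ f ⟨$⟩ a
      copair-at-inl x a a↦x with inl-or-inr x
      ... | inj₁ (a′ , a′↦x) = ⟨$⟩-cong f (trans a′↦x (sym a↦x))
      ... | inj₂ (b , b↦x)   = ⊥-elim (inl≢inr a b (trans a↦x (sym b↦x)))

      copair-at-inr : ∀ x b → inr ⟨$⟩ b ≡ proj₁ x → copair ⟨$⟩ x ≡ g ⟨$⟩ b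
      copair-at-inr x b b↦x with inl-or-inr x
      ... | inj₁ (a , a↦x)   = ⊥-elim (inl≢inr a b (trans a↦x (sym b↦x)))
      ... | inj₂ (b′ , b′↦x) = ⟨$⟩-cong g (injective inr b′ b (trans b′↦x (sym b↦x)))

point-set : FinSetℕ
point-set = 0 ∷ [] , Linked.[-]

⋆ : El point-set
⋆ = 0 , _

point : ∀ {A} → El A → InjFun point-set A
point a = inj (λ _ → a) (λ z w _ → trans (is-zero z) (sym (is-zero w)))
  where
  is-zero : (z : El point-set) → proj₁ z ≡ 0
  is-zero z with ∈-element {point-set} z
  ... | here z≡0 = z≡0

module _ {P X Y Q : FinSetℕ}
         (u : InjFun P X) (u′ : InjFun P Y) (x : InjFun X Q) (x′ : InjFun Y Q) where

  CoversCoincidences : Set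
  CoversCoincidences = ∀ a b → x ⟨$⟩ a ≡ x′ ⟨$⟩ b →
    Σ[ p ∈ El P ] (u ⟨$⟩ p ≡ proj₁ a × u′ ⟨$⟩ p ≡ proj₁ b)

  coversCoincidences⇒isPullback :
    (x ∘W u) ≈W (x′ ∘W u′) → CoversCoincidences → IsPullback W u u′ x x′
  coversCoincidences⇒isPullback commutes covers = commutes , universal
    where
    universal : ∀ {R} (v : InjFun R X) (v′ : InjFun R Y) → (x ∘W v) ≈W (x′ ∘W v′) →
                Σ[ h ∈ InjFun R P ] (((u ∘W h) ≈W v × (u′ ∘W h) ≈W v′) ×
                  (∀ h′ → (u ∘W h′) ≈W v → (u′ ∘W h′) ≈W v′ → h′ ≈W h))
    universal {R} v v′ xv≈x′v′ = h , (uh≈v , u′h≈v′) , unique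
      where
      preimage : ∀ c → Σ[ p ∈ El P ] (u ⟨$⟩ p ≡ v ⟨$⟩ c × u′ ⟨$⟩ p ≡ v′ ⟨$⟩ c)
      preimage c = covers (fun v c) (fun v′ c) (xv≈x′v′ c)

      uh≈v : ∀ c → u ⟨$⟩ proj₁ (preimage c) ≡ v ⟨$⟩ c
      uh≈v c = proj₁ (proj₂ (preimage c))

      u′h≈v′ : ∀ c → u′ ⟨$⟩ proj₁ (preimage c) ≡ v′ ⟨$⟩ c
      u′h≈v′ c = proj₂ (proj₂ (preimage c))

      h : InjFun R P
      h = inj (λ c → proj₁ (preimage c)) λ c d hc≡hd →
        injective v′ c d (trans (sym (u′h≈v′ c)) (trans (⟨$⟩-cong u′ hc≡hd) (u′h≈v′ d)))

      unique : ∀ h′ → (u ∘W h′) ≈W v → (u′ ∘W h′) ≈W v′ → h′ ≈W h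
      unique h′ _ u′h′≈v′ c =
        injective u′ (fun h′ c) (fun h c) (trans (u′h′≈v′ c) (sym (u′h≈v′ c)))

  isPullback⇒coversCoincidences : IsPullback W u u′ x x′ → CoversCoincidences
  isPullback⇒coversCoincidences (_ , universal) a b xa≡x′b
    with universal (point a) (point b) (λ _ → xa≡x′b)
  ... | h , (uh≈a , u′h≈b) , _ = fun h ⋆ , uh≈a ⋆ , u′h≈b ⋆

module Pullback {X Y Q : FinSetℕ} (x : InjFun X Q) (x′ : InjFun Y Q) where

  private
    module P = Subset X (λ a → image? x′ (x ⟨$⟩ a))

  apex : FinSetℕ
  apex = P.set

  π₁ : InjFun apex X
  π₁ = P.incl

  π₂-fun : El apex → El Y
  π₂-fun p = proj₁ (P.incl-sat p)

  commutes : ∀ p → x ⟨$⟩ fun π₁ p ≡ x′ ⟨$⟩ π₂-fun p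
  commutes p = sym (proj₂ (P.incl-sat p))

  π₂ : InjFun apex Y
  π₂ = inj π₂-fun λ p q π₂p≡π₂q → injective x (fun π₁ p) (fun π₁ q)
    (trans (commutes p) (trans (⟨$⟩-cong x′ π₂p≡π₂q) (sym (commutes q))))

  covers : CoversCoincidences π₁ π₂ x x′
  covers a b xa≡x′b =
    p , refl , injective x′ (π₂-fun p) b (trans (sym (commutes p)) (trans (⟨$⟩-cong x refl) xa≡x′b))
    where
    p : El apex
    p = P.restrict a (b , sym xa≡x′b)

  isPullback : IsPullback W π₁ π₂ x x′
  isPullback = coversCoincidences⇒isPullback π₁ π₂ x x′ commutes covers

module Completion {P X Y : FinSetℕ} (u : InjFun P X) (u′ : InjFun P Y) where

  private
    module Y∖u′ = Subset Y (λ b → ¬? (image? u′ (proj₁ b)))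
    open Injections X Y∖u′.set

  apex : FinSetℕ
  apex = X ⊎ₛ Y∖u′.set

  ι : InjFun X apex
  ι = inl

  ι′-fun : El Y → El apex
  ι′-fun b with image? u′ (proj₁ b)
  ... | yes (p , _) = fun inl (fun u p)
  ... | no b∉u′     = fun inr (Y∖u′.restrict b b∉u′)

  ι′-on-image : ∀ b p → u′ ⟨$⟩ p ≡ proj₁ b → proj₁ (ι′-fun b) ≡ inl ⟨$⟩ fun u p
  ι′-on-image b p u′p≡b with image? u′ (proj₁ b)
  ... | yes (p₀ , u′p₀≡b) = ⟨$⟩-cong u (injective u′ p₀ p (trans u′p₀≡b (sym u′p≡b)))
  ... | no b∉u′           = ⊥-elim (b∉u′ (p , u′p≡b))

  ι′-off-image : ∀ b (b∉u′ : ¬ Image u′ (proj₁ b)) →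
                 proj₁ (ι′-fun b) ≡ inr ⟨$⟩ Y∖u′.restrict b b∉u′
  ι′-off-image b b∉u′ with image? u′ (proj₁ b)
  ... | yes b∈u′ = ⊥-elim (b∉u′ b∈u′)
  ... | no _     = refl

  ι′ : InjFun Y apex
  ι′ = inj ι′-fun ι′-injective
    where
    ι′-injective : ∀ b c → proj₁ (ι′-fun b) ≡ proj₁ (ι′-fun c) → proj₁ b ≡ proj₁ c
    ι′-injective b c ι′b≡ι′c with image? u′ (proj₁ b) | image? u′ (proj₁ c)
    ... | yes (p , u′p≡b) | yes (q , u′q≡c) =
      trans (sym u′p≡b) (trans (⟨$⟩-cong u′ (injective u p q ι′b≡ι′c)) u′q≡c)
    ... | yes (p , _) | no c∉u′ =
      ⊥-elim (inl≢inr (fun u p) (Y∖u′.restrict c c∉u′) ι′b≡ι′c)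
    ... | no b∉u′ | yes (q , _) =
      ⊥-elim (inl≢inr (fun u q) (Y∖u′.restrict b b∉u′) (sym ι′b≡ι′c))
    ... | no b∉u′ | no c∉u′ =
      injective inr (Y∖u′.restrict b b∉u′) (Y∖u′.restrict c c∉u′) ι′b≡ι′c

  commutes : (ι ∘W u) ≈W (ι′ ∘W u′)
  commutes p = sym (ι′-on-image (fun u′ p) p refl)

  covers : CoversCoincidences u u′ ι ι′
  covers a b ιa≡ι′b = by-cases (image? u′ (proj₁ b))
    where
    by-cases : Dec (Image u′ (proj₁ b)) → Σ[ p ∈ El P ] (u ⟨$⟩ p ≡ proj₁ a × u′ ⟨$⟩ p ≡ proj₁ b)
    by-cases (yes (p , u′p≡b)) = p , sym (trans ιa≡ι′b (ι′-on-image b p u′p≡b)) , u′p≡b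
    by-cases (no b∉u′)         =
      ⊥-elim (inl≢inr a (Y∖u′.restrict b b∉u′) (trans ιa≡ι′b (ι′-off-image b b∉u′)))

  isPullback : IsPullback W u u′ ι ι′
  isPullback = coversCoincidences⇒isPullback u u′ ι ι′ commutes covers

  module Mediator {Q₁ : FinSetℕ} (x₁ : InjFun X Q₁) (x₁′ : InjFun Y Q₁)
                  (pb : IsPullback W u u′ x₁ x₁′) where
    open ≡-Reasoning

    disjoint : ∀ a c → x₁ ⟨$⟩ a ≢ (x₁′ ∘W Y∖u′.incl) ⟨$⟩ c
    disjoint a c x₁a≡x₁′c
      with isPullback⇒coversCoincidences u u′ x₁ x₁′ pb a (fun Y∖u′.incl c) x₁a≡x₁′c
    ... | p , _ , u′p≡c = Y∖u′.incl-sat c (p , u′p≡c)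

    t : InjFun apex Q₁
    t = copair x₁ (x₁′ ∘W Y∖u′.incl) disjoint

    x₁≈t∘ι : x₁ ≈W (t ∘W ι)
    x₁≈t∘ι a = sym (copair-at-inl x₁ _ disjoint (fun inl a) a refl)

    x₁′≈t∘ι′ : x₁′ ≈W (t ∘W ι′)
    x₁′≈t∘ι′ b = by-cases (image? u′ (proj₁ b))
      where
      by-cases : Dec (Image u′ (proj₁ b)) → x₁′ ⟨$⟩ b ≡ t ⟨$⟩ ι′-fun b
      by-cases (yes (p , u′p≡b)) = sym (begin
        t ⟨$⟩ ι′-fun b    ≡⟨ copair-at-inl x₁ _ disjoint (ι′-fun b) (fun u p)
                                (sym (ι′-on-image b p u′p≡b)) ⟩
        x₁ ⟨$⟩ fun u p    ≡⟨ proj₁ pb p ⟩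
        x₁′ ⟨$⟩ fun u′ p  ≡⟨ ⟨$⟩-cong x₁′ u′p≡b ⟩
        x₁′ ⟨$⟩ b         ∎)
      by-cases (no b∉u′) = sym (begin
        t ⟨$⟩ ι′-fun b                              ≡⟨ copair-at-inr x₁ _ disjoint (ι′-fun b) c
                                                         (sym (ι′-off-image b b∉u′)) ⟩
        x₁′ ⟨$⟩ fun Y∖u′.incl c                     ≡⟨ ⟨$⟩-cong x₁′ refl ⟩
        x₁′ ⟨$⟩ b                                    ∎)
        where
        c : El Y∖u′.set
        c = Y∖u′.restrict b b∉u′

    unique : ∀ t′ → x₁ ≈W (t′ ∘W ι) → x₁′ ≈W (t′ ∘W ι′) → t′ ≈W t
    unique t′ x₁≈t′∘ι x₁′≈t′∘ι′ = ⊎ₛ-ext t′ t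
      (λ a → trans (sym (x₁≈t′∘ι a)) (x₁≈t∘ι a))
      (λ c → begin
        t′ ⟨$⟩ fun inr c                ≡⟨ ⟨$⟩-cong t′ (sym (ι′-off-image (fun Y∖u′.incl c)
                                                                      (Y∖u′.incl-sat c))) ⟩
        t′ ⟨$⟩ ι′-fun (fun Y∖u′.incl c)  ≡⟨ x₁′≈t′∘ι′ (fun Y∖u′.incl c) ⟨
        x₁′ ⟨$⟩ fun Y∖u′.incl c         ≡⟨ copair-at-inr x₁ _ disjoint (fun inr c) c refl ⟨
        t ⟨$⟩ fun inr c                 ∎)

  isMinimalPullback : IsMinimalPullback W u u′ ι ι′
  isMinimalPullback = isPullback , λ x₁ x₁′ pb →
    let open Mediator x₁ x₁′ pb in t , (x₁≈t∘ι , x₁′≈t∘ι′) , unique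

factorisation-inclusion-iso : ∀ {A C} (f : InjFun A C) →
  Σ[ B ∈ FinSetℕ ] Σ[ j ∈ InjFun A B ] Σ[ k ∈ InjFun B C ]
    (IsSubsetInclusion j × IsIso W k × f ≈W (k ∘W j))
factorisation-inclusion-iso {A} {C} f = apex , ι , proj₁ factor , (λ _ → refl) , proj₂ factor
  where
  open Completion (idW {A}) f
  factor : Σ[ k ∈ InjFun apex C ] (IsIso W k × f ≈W (k ∘W ι))
  factor = idSpan-minimalPullback⇒factorisation W {f = f} {ι} {ι′} isMinimalPullback

factorisation-iso-inclusion : ∀ {A C} (f : InjFun A C) →
  Σ[ B ∈ FinSetℕ ] Σ[ k ∈ InjFun A B ] Σ[ j ∈ InjFun B C ]
    (IsIso W k × IsSubsetInclusion j × f ≈W (j ∘W k))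
factorisation-iso-inclusion {A} {C} f =
  I.set , corestriction , I.incl , surjective⇒isIso corestriction I.incl-sat , (λ _ → refl) , (λ _ → refl)
  where
  module I = Subset C (λ c → image? f (proj₁ c))

  corestriction : InjFun A I.set
  corestriction = inj (λ a → I.restrict (fun f a) (a , refl)) (injective f)

subsetInclusions : IsInclusionSubcategory W IsSubsetInclusion
subsetInclusions = record
  { incl-id         = λ _ → refl
  ; incl-∘          = λ {_} {_} {_} {_} {g} f-incl g-incl a → trans (f-incl (fun g a)) (g-incl a)
  ; incl-thin       = λ f-incl g-incl a → trans (f-incl a) (sym (g-incl a))
  ; incl-antisym    = λ {_} {_} {f} {g} f-incl g-incl →
                        FinSetℕ-≡ (inclusion⇒⊆ f f-incl) (inclusion⇒⊆ g g-incl)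
  ; factor-incl-iso = factorisation-inclusion-iso
  ; factor-iso-incl = factorisation-iso-inclusion
  }

proposition3p3 : IsCategoryOfWorlds W IsSubsetInclusion
proposition3p3 = record
  { pullbacks         = λ x x′ → let open Pullback x x′ in apex , π₁ , π₂ , isPullback
  ; minimal-pullbacks = λ u u′ → let open Completion u u′ in apex , ι , ι′ , isMinimalPullback
  ; inclusions        = subsetInclusions
  }
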